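{- Consider any sequence of operations, starting from an empty forest, on a heap-ordered forest, where each operation is one of: $\mathit{insert}(v)$ (create a new one-node tree consisting of a new node $v$), $\mathit{cut}(v)$ (delete the arc from $v$ to its parent, if any), $\mathit{delete}(v)$ (remove a leaf $v$), $\mathit{merge}(v,w)$, and the queries $\mathit{parent}$, $\mathit{root}$, $\mathit{nca}$ (which do not change the forest). Let $m$ be the number of merge operations and $n$ the number of inserted nodes that are eventually in trees that participate in merges. For a merge operation, say that a node's parent changes in it if the parent of the node (possibly null) immediately after the merge differs from its parent immediately before. Then the total, over all merge operations, of the number of nodes whose parent changes is $O(m\log n)$.
   Context: A heap-ordered forest is a set of node-disjoint rooted trees whose nodes are distinct elements of a totally ordered set (each node is identified with its label), such that every non-root node $v$ satisfies $v>p(v)$, where $p(v)$ is the parent of $v$; null is regarded as smaller than every node. For nodes $v,w$, $\mathit{nca}(v,w)$ is their nearest common ancestor (null if they are in different trees). The operation $\mathit{merge}(v,w)$ is defined as follows: let $P$ and $Q$ be the paths from $v$ and $w$, respectively, to the roots of their trees; the forest is restructured so that every node $z$ of $P\cup Q$ gets as its new parent the largest node of $P\cup Q$ that is smaller than $z$ (null if there is none), while all other nodes keep their parents. (A link operation making a root $v$ a child of a node $w$ in another tree with $v> w$ is counted as $\mathit{merge}(v,w)$.) A node that is deleted and reinserted counts as a new node. -}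

module Defs where

open import Data.Nat using (ℕ; zero; suc; _+_; _∸_; _⊔_; _≡ᵇ_; _<ᵇ_)
open import Data.Bool using (Bool; true; false; if_then_else_; not; _∧_; _∨_)
open import Data.Maybe using (Maybe; just; nothing; maybe′)
open import Data.List using (List; []; _∷_; _++_; upTo; map; length; take; foldl)
open import Data.Bool.ListAction using (any; all)
open import Data.Product using (_×_)
open import Data.Unit using (⊤)
open import Relation.Binary.PropositionalEquality using (_≡_; _≢_)

-- Node labels are natural numbers (with their usual total order).
-- A label may be reused after its node has been deleted; the reinserted
-- node is a *new* node (node identity = insertion event).

record Forest : Set where
  field
    present : ℕ → Bool
    par     : ℕ → Maybe ℕ
open Forest public

emptyForest : Forest
emptyForest = record { present = λ _ → false ; par = λ _ → nothing }

setFun : {A : Set} → (ℕ → A) → ℕ → A → (ℕ → A)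
setFun f x a z = if z ≡ᵇ x then a else f z

-- The path from v to the root of its tree (v first).  Since parents are
-- smaller than children in a heap-ordered forest, fuel (suc v) suffices.
ancestors : Forest → ℕ → ℕ → List ℕ
ancestors F zero    v = []
ancestors F (suc k) v = v ∷ maybe′ (ancestors F k) [] (par F v)

pathToRoot : Forest → ℕ → List ℕ
pathToRoot F v = ancestors F (suc v) v

rootFuel : Forest → ℕ → ℕ → ℕ
rootFuel F zero    v = v
rootFuel F (suc k) v = maybe′ (rootFuel F k) v (par F v)

root : Forest → ℕ → ℕ
root F v = rootFuel F (suc v) v

elemᵇ : ℕ → List ℕ → Bool
elemᵇ z xs = any (λ x → z ≡ᵇ x) xs

maxMaybe : Maybe ℕ → Maybe ℕ → Maybe ℕ
maxMaybe nothing  b        = b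
maxMaybe (just a) nothing  = just a
maxMaybe (just a) (just b) = just (a ⊔ b)

largestBelow : List ℕ → ℕ → Maybe ℕ
largestBelow []       z = nothing
largestBelow (x ∷ xs) z =
  if x <ᵇ z then maxMaybe (just x) (largestBelow xs z) else largestBelow xs z

mergeForest : Forest → ℕ → ℕ → Forest
mergeForest F v w = record F { par = newPar }
  where
    PQ : List ℕ
    PQ = pathToRoot F v ++ pathToRoot F w
    newPar : ℕ → Maybe ℕ
    newPar z = if elemᵇ z PQ then largestBelow PQ z else par F z

eqMaybeᵇ : Maybe ℕ → Maybe ℕ → Bool
eqMaybeᵇ nothing  nothing  = true
eqMaybeᵇ (just a) (just b) = a ≡ᵇ b
eqMaybeᵇ _        _        = false

countᵇ : (ℕ → Bool) → List ℕ → ℕ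
countᵇ p []       = 0
countᵇ p (x ∷ xs) = (if p x then 1 else 0) + countᵇ p xs

-- Number of nodes whose parent changes in merge(v,w) applied to F.
-- Only nodes on P ∪ Q can change, and these are all ≤ v ⊔ w, so it
-- suffices to count over the labels 0 .. v ⊔ w.
parentChanges : Forest → ℕ → ℕ → ℕ
parentChanges F v w =
  countᵇ (λ z → not (eqMaybeᵇ (par (mergeForest F v w) z) (par F z)))
         (upTo (suc (v ⊔ w)))

data Op : Set where
  insert   : ℕ → Op
  cut      : ℕ → Op
  delete   : ℕ → Op
  merge    : ℕ → ℕ → Op
  parentQ  : ℕ → Op
  rootQ    : ℕ → Op
  ncaQ     : ℕ → ℕ → Op

Pre : Forest → Op → Set
Pre F (insert v)  = present F v ≡ false
Pre F (cut v)     = present F v ≡ true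
Pre F (delete v)  = present F v ≡ true × (∀ u → present F u ≡ true → par F u ≢ just v)
Pre F (merge v w) = present F v ≡ true × present F w ≡ true
Pre F (parentQ v) = present F v ≡ true
Pre F (rootQ v)   = present F v ≡ true
Pre F (ncaQ v w)  = present F v ≡ true × present F w ≡ true

step : Forest → Op → Forest
step F (insert v)  = record { present = setFun (present F) v true ; par = setFun (par F) v nothing }
step F (cut v)     = record F { par = setFun (par F) v nothing }
step F (delete v)  = record { present = setFun (present F) v false ; par = setFun (par F) v nothing }
step F (merge v w) = mergeForest F v w
step F (parentQ v) = F
step F (rootQ v)   = F
step F (ncaQ v w)  = F

Valid : Forest → List Op → Set
Valid F []       = ⊤
Valid F (o ∷ os) = Pre F o × Valid (step F o) os

run : Forest → List Op → Forest
run F os = foldl step F os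

stateBefore : List Op → ℕ → Forest
stateBefore ops j = run emptyForest (take j ops)

opAt : List Op → ℕ → Maybe Op
opAt []       _       = nothing
opAt (o ∷ os) zero    = just o
opAt (o ∷ os) (suc k) = opAt os k

totalChanges : Forest → List Op → ℕ
totalChanges F []               = 0
totalChanges F (merge v w ∷ os) = parentChanges F v w + totalChanges (mergeForest F v w) os
totalChanges F (o ∷ os)         = totalChanges (step F o) os

numMerges : List Op → ℕ
numMerges []               = 0
numMerges (merge _ _ ∷ os) = suc (numMerges os)
numMerges (_ ∷ os)         = numMerges os

range : ℕ → ℕ → List ℕ
range a b = map (a +_) (upTo (b ∸ a))

isDeleteOf : ℕ → Maybe Op → Bool
isDeleteOf x (just (delete y)) = x ≡ᵇ y
isDeleteOf x _                 = false

mergeTouches : List Op → ℕ → ℕ → Bool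
mergeTouches ops x j with opAt ops j
... | just (merge v w) =
        let F = stateBefore ops j in
        (root F x ≡ᵇ root F v) ∨ (root F x ≡ᵇ root F w)
... | _ = false

participates : List Op → ℕ → ℕ → Bool
participates ops i x =
  any (λ j → mergeTouches ops x j ∧ all (λ k → not (isDeleteOf x (opAt ops k))) (range (suc i) j))
      (range (suc i) (length ops))

insertParticipates : List Op → ℕ → Bool
insertParticipates ops i with opAt ops i
... | just (insert x) = participates ops i x
... | _               = false

numParticipating : List Op → ℕ
numParticipating ops = countᵇ (insertParticipates ops) (upTo (length ops))

-- Give every node x a rank r x, the number of participating insertions of smaller labels, so that
-- 0 ≤ r x ≤ n, and let the potential of a forest be Φ = Σₓ ⌊log₂ (r x − r (parent x))⌋. Insertions,
-- cuts and deletions only make parents null, so they never increase Φ. In merge(v,w) only nodes of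
-- the two root paths P and Q change parent; take them in increasing order. If z changes parent from
-- p and the previously changed node c satisfies p < c, the new parents y of z and y′ of c satisfy
-- p ≤ y′ < c ≤ y < z: the two new rank gaps fit disjointly into the old gap of z, so their logarithms
-- add up to less than twice the old one. Otherwise z has a sibling on P ∪ Q below it and is a root
-- of P or Q or the first node of one path whose parent lies on the other; there are at most four
-- such nodes. Amortizing along the changed nodes gives changes + 2Φ′ ≤ 2Φ + 9(1 + ⌊log₂ n⌋) for
-- every merge, and summing over the sequence bounds the total by 9 m (1 + ⌊log₂ n⌋).

module Submission where

open import Defs
open import Data.Bool using (Bool; true; false; T; not; _∧_; _∨_; if_then_else_)
open import Data.Bool.Properties using (T-∧; T-∨)
open import Data.Empty using (⊥; ⊥-elim)
open import Data.List using (List; []; _∷_; _++_; _∷ʳ_; upTo; length; take; drop)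
open import Data.List.Properties using (upTo-∷ʳ; foldl-∷ʳ)
open import Data.List.Membership.Propositional using (_∈_; _∉_; lose)
open import Data.List.Membership.Propositional.Properties
  using (∈-++⁺ˡ; ∈-++⁺ʳ; ∈-++⁻; ∈-upTo⁺; ∈-upTo⁻; ∈-map⁺; ∈-map⁻)
import Data.List.Relation.Unary.All as All
open import Data.List.Relation.Unary.All.Properties using (all⁻)
open import Data.List.Relation.Unary.Any using (here; there)
import Data.List.Relation.Unary.Any as Any
open import Data.List.Relation.Unary.Any.Properties using (any⁺; any⁻)
open import Data.Maybe using (Maybe; just; nothing; maybe; maybe′; is-nothing)
open import Data.Nat
open import Data.Nat.Induction using (<-wellFounded)
open import Data.Nat.Logarithm using (⌊log₂_⌋; ⌊log₂⌋-mono-≤; ⌊log₂[2*b]⌋≡1+⌊log₂b⌋)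
open import Data.Nat.Properties
open import Data.Nat.Tactic.RingSolver using (solve-∀)
open import Data.Product using (∃-syntax; _×_; _,_; proj₁; proj₂)
import Data.Product as Product
open import Data.Sum using (_⊎_; inj₁; inj₂; [_,_]′)
import Data.Sum as Sum
open import Function using (_∘′_)
open import Function.Bundles using (Equivalence)
open import Induction.WellFounded using (Acc; acc)
open import Relation.Nullary using (¬_; yes; no)
open import Relation.Nullary.Decidable using (T?)
open import Relation.Nullary.Reflects using (ofʸ; ofⁿ)
open import Relation.Binary.PropositionalEquality

open import Algebra.Properties.CommutativeSemigroup *-commutativeSemigroup using (xy∙z≈xz∙y)
open import Data.List.Membership.DecPropositional _≟_ using (_∈?_)
open Equivalence using (to; from)

𝟙 : Bool → ℕ
𝟙 b = if b then 1 else 0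

𝟙-T : ∀ {b} → T b → 𝟙 b ≡ 1
𝟙-T {true} _ = refl

𝟙-¬T : ∀ {b} → ¬ T b → 𝟙 b ≡ 0
𝟙-¬T {true}  ¬t = ⊥-elim (¬t _)
𝟙-¬T {false} _  = refl

𝟙-∨ : ∀ a b → 𝟙 (a ∨ b) ≤ 𝟙 a + 𝟙 b
𝟙-∨ true  _ = s≤s z≤n
𝟙-∨ false _ = ≤-refl

T-not⁺ : ∀ {b} → ¬ T b → T (not b)
T-not⁺ {false} _ = _
T-not⁺ {true}  ¬t = ¬t _

T-not⁻ : ∀ {b} → T (not b) → ¬ T b
T-not⁻ {false} _ ()

sumBelow : (ℕ → ℕ) → ℕ → ℕ
sumBelow f zero    = 0
sumBelow f (suc n) = sumBelow f n + f n

module _ {f g : ℕ → ℕ} where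

  sumBelow-mono-≤ : (∀ x → f x ≤ g x) → ∀ n → sumBelow f n ≤ sumBelow g n
  sumBelow-mono-≤ f≤g zero    = z≤n
  sumBelow-mono-≤ f≤g (suc n) = +-mono-≤ (sumBelow-mono-≤ f≤g n) (f≤g n)

  sumBelow-distrib-+ : ∀ n → sumBelow (λ x → f x + g x) n ≡ sumBelow f n + sumBelow g n
  sumBelow-distrib-+ zero    = refl
  sumBelow-distrib-+ (suc n) rewrite sumBelow-distrib-+ n =
    +-assoc-comm (sumBelow f n) (sumBelow g n) (f n) (g n)
    where
    +-assoc-comm : ∀ a b c d → a + b + (c + d) ≡ a + c + (b + d)
    +-assoc-comm = solve-∀

sumBelow-*-distribˡ : ∀ k (f : ℕ → ℕ) n → sumBelow (λ x → k * f x) n ≡ k * sumBelow f n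
sumBelow-*-distribˡ k f zero    = sym (*-zeroʳ k)
sumBelow-*-distribˡ k f (suc n) rewrite sumBelow-*-distribˡ k f n =
  sym (*-distribˡ-+ k (sumBelow f n) (f n))

sumBelow-zero : ∀ (f : ℕ → ℕ) n → (∀ {x} → x < n → f x ≡ 0) → sumBelow f n ≡ 0
sumBelow-zero f zero    f≡0 = refl
sumBelow-zero f (suc n) f≡0 = cong₂ _+_ (sumBelow-zero f n (λ x<n → f≡0 (m<n⇒m<1+n x<n))) (f≡0 ≤-refl)

sumBelow-stable : ∀ (f : ℕ → ℕ) m → (∀ {x} → m ≤ x → f x ≡ 0) →
                  ∀ {n} → m ≤ n → sumBelow f n ≡ sumBelow f m
sumBelow-stable f m f≡0 {n} m≤n with m≤n⇒m<n∨m≡n m≤n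
... | inj₂ refl = refl
sumBelow-stable f m f≡0 {suc n} m≤n | inj₁ m<1+n =
  trans (cong₂ _+_ (sumBelow-stable f m f≡0 (≤-pred m<1+n)) (f≡0 (≤-pred m<1+n))) (+-identityʳ _)

sumBelow-𝟙-∨ : ∀ (p q : ℕ → Bool) n →
               sumBelow (λ x → 𝟙 (p x ∨ q x)) n ≤ sumBelow (λ x → 𝟙 (p x)) n + sumBelow (λ x → 𝟙 (q x)) n
sumBelow-𝟙-∨ p q n = ≤-trans (sumBelow-mono-≤ (λ x → 𝟙-∨ (p x) (q x)) n)
                             (≤-reflexive (sumBelow-distrib-+ {λ x → 𝟙 (p x)} {λ x → 𝟙 (q x)} n))

sumBelow-𝟙-≤1 : ∀ (p : ℕ → Bool) → (∀ {x y} → T (p x) → T (p y) → x ≡ y) →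
                ∀ n → sumBelow (λ x → 𝟙 (p x)) n ≤ 1
sumBelow-𝟙-≤1 p unique zero = z≤n
sumBelow-𝟙-≤1 p unique (suc n) with T? (p n)
... | no ¬pn = subst (_≤ 1) (sym (trans (cong (sumBelow (λ x → 𝟙 (p x)) n +_) (𝟙-¬T ¬pn)) (+-identityʳ _)))
                     (sumBelow-𝟙-≤1 p unique n)
... | yes pn = ≤-reflexive (cong₂ _+_ (sumBelow-zero _ n below) (𝟙-T pn))
  where
  below : ∀ {x} → x < n → 𝟙 (p x) ≡ 0
  below x<n = 𝟙-¬T (λ px → <-irrefl (unique px pn) x<n)

countᵇ-++ : ∀ (p : ℕ → Bool) xs ys → countᵇ p (xs ++ ys) ≡ countᵇ p xs + countᵇ p ys
countᵇ-++ p []       ys = refl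
countᵇ-++ p (x ∷ xs) ys = trans (cong (𝟙 (p x) +_) (countᵇ-++ p xs ys)) (sym (+-assoc (𝟙 (p x)) _ _))

countᵇ-upTo : ∀ (p : ℕ → Bool) n → countᵇ p (upTo n) ≡ sumBelow (λ x → 𝟙 (p x)) n
countᵇ-upTo p zero    = refl
countᵇ-upTo p (suc n) = begin
  countᵇ p (upTo (suc n))          ≡⟨ cong (countᵇ p) (sym (upTo-∷ʳ n)) ⟩
  countᵇ p (upTo n ++ n ∷ [])      ≡⟨ countᵇ-++ p (upTo n) (n ∷ []) ⟩
  countᵇ p (upTo n) + (𝟙 (p n) + 0) ≡⟨ cong₂ _+_ (countᵇ-upTo p n) (+-identityʳ _) ⟩
  sumBelow (λ x → 𝟙 (p x)) n + 𝟙 (p n) ∎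
  where open ≡-Reasoning

countᵇ-mono : ∀ {p q : ℕ → Bool} → (∀ {x} → T (p x) → T (q x)) → ∀ xs → countᵇ p xs ≤ countᵇ q xs
countᵇ-mono {p} {q} p⇒q [] = z≤n
countᵇ-mono {p} {q} p⇒q (x ∷ xs) with p x | q x | p⇒q {x}
... | true  | true  | _  = s≤s (countᵇ-mono p⇒q xs)
... | false | true  | _  = m≤n⇒m≤1+n (countᵇ-mono p⇒q xs)
... | false | false | _  = countᵇ-mono p⇒q xs
... | true  | false | pq = ⊥-elim (pq _)

countᵇ-mono-< : ∀ {p q : ℕ → Bool} → (∀ {x} → T (p x) → T (q x)) →
                ∀ {x xs} → x ∈ xs → ¬ T (p x) → T (q x) → countᵇ p xs < countᵇ q xs
countᵇ-mono-< {p} {q} p⇒q {xs = x ∷ xs} (here refl) ¬px qx with p x | q x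
... | false | true = s≤s (countᵇ-mono p⇒q xs)
... | true  | _    = ⊥-elim (¬px _)
countᵇ-mono-< {p} {q} p⇒q {xs = y ∷ xs} (there x∈) ¬px qx with p y | q y | p⇒q {y}
... | true  | true  | _  = s≤s (countᵇ-mono-< p⇒q x∈ ¬px qx)
... | false | true  | _  = m<n⇒m<1+n (countᵇ-mono-< p⇒q x∈ ¬px qx)
... | false | false | _  = countᵇ-mono-< p⇒q x∈ ¬px qx
... | true  | false | pq = ⊥-elim (pq _)

⌊log₂⌋-+-< : ∀ {x y z} → 0 < x → 0 < y → x + y ≤ z → ⌊log₂ x ⌋ + ⌊log₂ y ⌋ < 2 * ⌊log₂ z ⌋
⌊log₂⌋-+-< {x} {y} {z} 0<x 0<y x+y≤z =
  [ ordered 0<x x+y≤z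
  , (λ y≤x → subst (_< 2 * ⌊log₂ z ⌋) (+-comm ⌊log₂ y ⌋ ⌊log₂ x ⌋)
                   (ordered 0<y (subst (_≤ z) (+-comm x y) x+y≤z) y≤x))
  ]′ (≤-total x y)
  where
  ordered : ∀ {x y} → 0 < x → x + y ≤ z → x ≤ y → ⌊log₂ x ⌋ + ⌊log₂ y ⌋ < 2 * ⌊log₂ z ⌋
  ordered {x} {y} 0<x x+y≤z x≤y =
    subst (⌊log₂ x ⌋ + ⌊log₂ y ⌋ <_) (cong (⌊log₂ z ⌋ +_) (sym (+-identityʳ _)))
          (+-mono-≤ 1+log₂x≤log₂z (⌊log₂⌋-mono-≤ (≤-trans (m≤n+m y x) x+y≤z)))
    where
    instance _ = >-nonZero 0<x
    2x≤z : 2 * x ≤ z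
    2x≤z = ≤-trans (≤-reflexive (cong (x +_) (+-identityʳ x))) (≤-trans (+-monoʳ-≤ x x≤y) x+y≤z)
    1+log₂x≤log₂z : 1 + ⌊log₂ x ⌋ ≤ ⌊log₂ z ⌋
    1+log₂x≤log₂z = subst (_≤ ⌊log₂ z ⌋) (⌊log₂[2*b]⌋≡1+⌊log₂b⌋ x) (⌊log₂⌋-mono-≤ 2x≤z)

[m∸n]+[n∸o]≡m∸o : ∀ {m n o} → o ≤ n → n ≤ m → (m ∸ n) + (n ∸ o) ≡ m ∸ o
[m∸n]+[n∸o]≡m∸o {m} {n} {o} o≤n n≤m = +-cancelʳ-≡ o _ _ (begin
  m ∸ n + (n ∸ o) + o   ≡⟨ +-assoc (m ∸ n) (n ∸ o) o ⟩
  m ∸ n + (n ∸ o + o)   ≡⟨ cong (m ∸ n +_) (m∸n+n≡m o≤n) ⟩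
  m ∸ n + n             ≡⟨ m∸n+n≡m n≤m ⟩
  m                     ≡⟨ sym (m∸n+n≡m (≤-trans o≤n n≤m)) ⟩
  m ∸ o + o             ∎)
  where open ≡-Reasoning

-- Amortization along the changed positions

data LastBelow (p : ℕ → Bool) (n : ℕ) : Maybe ℕ → Set where
  none : (∀ {x} → x < n → ¬ T (p x)) → LastBelow p n nothing
  some : ∀ {c} → c < n → T (p c) → (∀ {x} → c < x → x < n → ¬ T (p x)) → LastBelow p n (just c)

lastBelow-zero : ∀ p → LastBelow p 0 nothing
lastBelow-zero p = none (λ ())

lastBelow-skip : ∀ {p n l} → ¬ T (p n) → LastBelow p n l → LastBelow p (suc n) l
lastBelow-skip ¬pn (none below) =
  none (λ x<1+n → [ below , (λ { refl → ¬pn }) ]′ (m≤n⇒m<n∨m≡n (≤-pred x<1+n)))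
lastBelow-skip ¬pn (some c<n pc between) =
  some (m<n⇒m<1+n c<n) pc (λ c<x x<1+n → [ between c<x , (λ { refl → ¬pn }) ]′ (m≤n⇒m<n∨m≡n (≤-pred x<1+n)))

lastBelow-hit : ∀ {p n} → T (p n) → LastBelow p (suc n) (just n)
lastBelow-hit pn = some ≤-refl pn (λ n<x x<1+n → ⊥-elim (<-irrefl refl (<-≤-trans n<x (≤-pred x<1+n))))

module Amortization
  (changed breaks : ℕ → Bool) (a b : ℕ → ℕ) (N : ℕ)
  (a-unchanged : ∀ {x} → ¬ T (changed x) → a x ≡ 2 * b x)
  (b≤N : ∀ x → b x ≤ N)
  (changed-pays : ∀ {z l} → T (changed z) → LastBelow changed z l → T (breaks z) ⊎ b z + maybe b 0 l < a z)
  where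

  K : ℕ
  K = N + N + 1

  #changed #breaks : ℕ → ℕ
  #changed = sumBelow (λ x → 𝟙 (changed x))
  #breaks  = sumBelow (λ x → 𝟙 (breaks x))

  -- The last changed position l keeps its new gap b l as credit, which pays for the next changed
  -- position unless that one is a break.
  Invariant : ℕ → Maybe ℕ → Set
  Invariant n l = #changed n + 2 * sumBelow b n ≤ sumBelow a n + maybe b 0 l + K * #breaks n

  private
    open ≤-Reasoning

    unchanged-step : ∀ C B A X R i bn an r → i ≡ 0 → an ≡ 2 * bn →
      C + 2 * B ≤ A + X + K * R → C + i + 2 * (B + bn) ≤ A + an + X + K * (R + r)
    unchanged-step C B A X R _ bn _ r refl refl inv = begin
      C + 0 + 2 * (B + bn)         ≡⟨ lhs C B bn ⟩
      C + 2 * B + 2 * bn           ≤⟨ +-monoˡ-≤ (2 * bn) inv ⟩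
      A + X + K * R + 2 * bn       ≤⟨ m≤m+n _ (K * r) ⟩
      A + X + K * R + 2 * bn + K * r ≡⟨ rhs A X K R bn r ⟩
      A + 2 * bn + X + K * (R + r) ∎
      where
      lhs : ∀ C B bn → C + 0 + 2 * (B + bn) ≡ C + 2 * B + 2 * bn
      lhs = solve-∀
      rhs : ∀ A X k R bn r → A + X + k * R + 2 * bn + k * r ≡ A + 2 * bn + X + k * (R + r)
      rhs = solve-∀

    break-step : ∀ C B A X R i bn an r → i ≡ 1 → r ≡ 1 → X ≤ N → bn ≤ N →
      C + 2 * B ≤ A + X + K * R → C + i + 2 * (B + bn) ≤ A + an + bn + K * (R + r)
    break-step C B A X R _ bn an _ refl refl X≤N bn≤N inv = begin
      C + 1 + 2 * (B + bn)                ≡⟨ lhs C B bn ⟩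
      C + 2 * B + (1 + 2 * bn)            ≤⟨ +-monoˡ-≤ (1 + 2 * bn) inv ⟩
      A + X + K * R + (1 + 2 * bn)        ≡⟨ mid A X K R bn ⟩
      A + bn + K * R + (X + bn + 1)       ≤⟨ +-monoʳ-≤ (A + bn + K * R) (+-monoˡ-≤ 1 (+-mono-≤ X≤N bn≤N)) ⟩
      A + bn + K * R + K                  ≤⟨ m≤n+m _ an ⟩
      an + (A + bn + K * R + K)           ≡⟨ rhs A an bn K R ⟩
      A + an + bn + K * (R + 1)           ∎
      where
      lhs : ∀ C B bn → C + 1 + 2 * (B + bn) ≡ C + 2 * B + (1 + 2 * bn)
      lhs = solve-∀
      mid : ∀ A X k R bn → A + X + k * R + (1 + 2 * bn) ≡ A + bn + k * R + (X + bn + 1)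
      mid = solve-∀
      rhs : ∀ A an bn k R → an + (A + bn + k * R + k) ≡ A + an + bn + k * (R + 1)
      rhs = solve-∀

    paid-step : ∀ C B A X R i bn an r → i ≡ 1 → bn + X < an →
      C + 2 * B ≤ A + X + K * R → C + i + 2 * (B + bn) ≤ A + an + bn + K * (R + r)
    paid-step C B A X R _ bn an r refl bn+X<an inv = begin
      C + 1 + 2 * (B + bn)                ≡⟨ lhs C B bn ⟩
      C + 2 * B + (1 + 2 * bn)            ≤⟨ +-monoˡ-≤ (1 + 2 * bn) inv ⟩
      A + X + K * R + (1 + 2 * bn)        ≡⟨ mid A X K R bn ⟩
      A + bn + K * R + suc (bn + X)       ≤⟨ +-monoʳ-≤ (A + bn + K * R) bn+X<an ⟩
      A + bn + K * R + an                 ≤⟨ m≤m+n _ (K * r) ⟩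
      A + bn + K * R + an + K * r         ≡⟨ rhs A an bn K R r ⟩
      A + an + bn + K * (R + r)           ∎
      where
      lhs : ∀ C B bn → C + 1 + 2 * (B + bn) ≡ C + 2 * B + (1 + 2 * bn)
      lhs = solve-∀
      mid : ∀ A X k R bn → A + X + k * R + (1 + 2 * bn) ≡ A + bn + k * R + suc (bn + X)
      mid = solve-∀
      rhs : ∀ A an bn k R r → A + bn + k * R + an + k * r ≡ A + an + bn + k * (R + r)
      rhs = solve-∀

  credit≤N : ∀ l → maybe b 0 l ≤ N
  credit≤N nothing  = z≤n
  credit≤N (just c) = b≤N c

  invariant-unchanged : ∀ {n l} → ¬ T (changed n) → Invariant n l → Invariant (suc n) l
  invariant-unchanged {n} {l} ¬cn =
    unchanged-step (#changed n) (sumBelow b n) (sumBelow a n) (maybe b 0 l) (#breaks n)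
                   (𝟙 (changed n)) (b n) (a n) (𝟙 (breaks n)) (𝟙-¬T ¬cn) (a-unchanged ¬cn)

  invariant-break : ∀ {n l} → T (changed n) → T (breaks n) → Invariant n l → Invariant (suc n) (just n)
  invariant-break {n} {l} cn bn =
    break-step (#changed n) (sumBelow b n) (sumBelow a n) (maybe b 0 l) (#breaks n)
               (𝟙 (changed n)) (b n) (a n) (𝟙 (breaks n)) (𝟙-T cn) (𝟙-T bn) (credit≤N l) (b≤N n)

  invariant-paid : ∀ {n l} → T (changed n) → b n + maybe b 0 l < a n → Invariant n l → Invariant (suc n) (just n)
  invariant-paid {n} {l} cn paid =
    paid-step (#changed n) (sumBelow b n) (sumBelow a n) (maybe b 0 l) (#breaks n)
              (𝟙 (changed n)) (b n) (a n) (𝟙 (breaks n)) (𝟙-T cn) paid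

  invariant : ∀ n → ∃[ l ] LastBelow changed n l × Invariant n l
  invariant zero = nothing , lastBelow-zero changed , z≤n
  invariant (suc n) with invariant n | T? (changed n)
  ... | l , last , inv | no ¬cn = l , lastBelow-skip ¬cn last , invariant-unchanged {l = l} ¬cn inv
  ... | l , last , inv | yes cn =
    just n , lastBelow-hit cn ,
    [ (λ bn → invariant-break {l = l} cn bn inv) , (λ paid → invariant-paid {l = l} cn paid inv) ]′ (changed-pays cn last)

  amortized : ∀ n → #changed n + 2 * sumBelow b n ≤ sumBelow a n + N + K * #breaks n
  amortized n with invariant n
  ... | l , _ , inv = ≤-trans inv (+-monoˡ-≤ (K * #breaks n) (+-monoʳ-≤ (sumBelow a n) (credit≤N l)))

elemᵇ⇒∈ : ∀ {z} xs → T (elemᵇ z xs) → z ∈ xs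
elemᵇ⇒∈ {z} xs t = Any.map (≡ᵇ⇒≡ z _) (any⁻ (z ≡ᵇ_) xs t)

∈⇒elemᵇ : ∀ {z xs} → z ∈ xs → T (elemᵇ z xs)
∈⇒elemᵇ {z} z∈xs = any⁺ (z ≡ᵇ_) (Any.map (≡⇒≡ᵇ z _) z∈xs)

eqMaybeᵇ⇒≡ : ∀ a b → T (eqMaybeᵇ a b) → a ≡ b
eqMaybeᵇ⇒≡ nothing  nothing  _ = refl
eqMaybeᵇ⇒≡ (just a) (just b) t = cong just (≡ᵇ⇒≡ a b t)

eqMaybeᵇ-refl : ∀ a → T (eqMaybeᵇ a a)
eqMaybeᵇ-refl nothing  = _
eqMaybeᵇ-refl (just a) = ≡⇒≡ᵇ a a refl

≢⇒≡ᵇ≡false : ∀ {m n} → m ≢ n → (m ≡ᵇ n) ≡ false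
≢⇒≡ᵇ≡false {m} {n} m≢n with m ≡ᵇ n | ≡ᵇ⇒≡ m n
... | true  | m≡n = ⊥-elim (m≢n (m≡n _))
... | false | _   = refl

setFun-≡ : ∀ {A : Set} (f : ℕ → A) x a → setFun f x a x ≡ a
setFun-≡ f x a with x ≡ᵇ x | ≡⇒≡ᵇ x x refl
... | true | _ = refl

setFun-≢ : ∀ {A : Set} (f : ℕ → A) x a {z} → z ≢ x → setFun f x a z ≡ f z
setFun-≢ f x a {z} z≢x with z ≡ᵇ x | ≡ᵇ⇒≡ z x
... | true  | z≡x = ⊥-elim (z≢x (z≡x _))
... | false | _   = refl

data LargestBelow (L : List ℕ) (z : ℕ) : Maybe ℕ → Set where
  nothing : (∀ {u} → u ∈ L → z ≤ u) → LargestBelow L z nothing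
  just    : ∀ {y} → y ∈ L → y < z → (∀ {u} → u ∈ L → u < z → u ≤ y) → LargestBelow L z (just y)

largestBelow-view : ∀ L z → LargestBelow L z (largestBelow L z)
largestBelow-view []       z = nothing (λ ())
largestBelow-view (x ∷ xs) z
  with x <ᵇ z | <ᵇ-reflects-< x z | largestBelow xs z | largestBelow-view xs z
... | false | ofⁿ x≮z | _ | nothing above =
  nothing λ { (here refl) → ≮⇒≥ x≮z ; (there u∈xs) → above u∈xs }
... | false | ofⁿ x≮z | _ | just y∈xs y<z max =
  just (there y∈xs) y<z λ { (here refl) u<z → ⊥-elim (x≮z u<z) ; (there u∈xs) → max u∈xs }
... | true  | ofʸ x<z | _ | nothing above =
  just (here refl) x<z λ { (here refl) _ → ≤-refl ; (there u∈xs) u<z → ⊥-elim (<⇒≱ u<z (above u∈xs)) }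
... | true  | ofʸ x<z | _ | just {y} y∈xs y<z max =
  just x⊔y∈ (⊔-lub x<z y<z)
       λ { (here refl) _ → m≤m⊔n x y ; (there u∈xs) u<z → ≤-trans (max u∈xs u<z) (m≤n⊔m x y) }
  where
  x⊔y∈ : x ⊔ y ∈ x ∷ xs
  x⊔y∈ = [ here , (λ x⊔y≡y → there (subst (_∈ xs) (sym x⊔y≡y) y∈xs)) ]′ (⊔-sel x y)

-- Heap-ordered forests

record WellFormed (F : Forest) : Set where
  field
    par-<       : ∀ {x p} → par F x ≡ just p → p < x
    par-present : ∀ {x p} → par F x ≡ just p → present F p ≡ true
    absent-root : ∀ {x} → present F x ≡ false → par F x ≡ nothing

  has-parent⇒present : ∀ {x p} → par F x ≡ just p → present F x ≡ true
  has-parent⇒present {x} x→p with present F x in eq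
  ... | true  = refl
  ... | false with () ← trans (sym (absent-root eq)) x→p

open WellFormed public

data Ancestor (F : Forest) (x : ℕ) : ℕ → Set where
  here : Ancestor F x x
  up   : ∀ {y p} → par F y ≡ just p → Ancestor F x p → Ancestor F x y

module _ {F : Forest} where

  ancestor-trans : ∀ {x y z} → Ancestor F x y → Ancestor F y z → Ancestor F x z
  ancestor-trans x≼y here          = x≼y
  ancestor-trans x≼y (up z→p y≼p) = up z→p (ancestor-trans x≼y y≼p)

  ancestor-linear : ∀ {x y z} → Ancestor F x z → Ancestor F y z → Ancestor F x y ⊎ Ancestor F y x
  ancestor-linear here           y≼z            = inj₂ y≼z
  ancestor-linear x≼z            here           = inj₁ x≼z
  ancestor-linear (up z→p x≼p) (up z→q y≼q) with trans (sym z→p) z→q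
  ... | refl = ancestor-linear x≼p y≼q

  ancestor-of-root : ∀ {x y} → Ancestor F x y → par F y ≡ nothing → x ≡ y
  ancestor-of-root here         _     = refl
  ancestor-of-root (up y→p _) y-root with () ← trans (sym y-root) y→p

  ancestor-parent : ∀ {x y p} → Ancestor F x y → x ≢ y → par F y ≡ just p → Ancestor F x p
  ancestor-parent here           x≢x  _    = ⊥-elim (x≢x refl)
  ancestor-parent (up y→q x≼q) _    y→p with trans (sym y→q) y→p
  ... | refl = x≼q

  ∈-ancestors⁻ : ∀ k {x y} → x ∈ ancestors F k y → Ancestor F x y
  ∈-ancestors⁻ (suc k) {y = y} x∈ with par F y in y→
  ∈-ancestors⁻ (suc k) (here refl)  | _      = here
  ∈-ancestors⁻ (suc k) (there x∈)  | just p = up y→ (∈-ancestors⁻ k x∈)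

  ∈-pathToRoot⁻ : ∀ {x y} → x ∈ pathToRoot F y → Ancestor F x y
  ∈-pathToRoot⁻ {y = y} = ∈-ancestors⁻ (suc y)

  module _ (wf : WellFormed F) where

    ancestor-≤ : ∀ {x y} → Ancestor F x y → x ≤ y
    ancestor-≤ here          = ≤-refl
    ancestor-≤ (up y→p x≼p) = ≤-trans (ancestor-≤ x≼p) (<⇒≤ (par-< wf y→p))

    ∈-ancestors⁺ : ∀ k {x y} → Ancestor F x y → y < k → x ∈ ancestors F k y
    ∈-ancestors⁺ (suc k) here y<k = here refl
    ∈-ancestors⁺ (suc k) {y = y} (up y→p x≼p) y<k with par F y in y→ | y→p
    ... | just p | refl = there (∈-ancestors⁺ k x≼p (<-≤-trans (par-< wf y→) (≤-pred y<k)))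

    ∈-pathToRoot⁺ : ∀ {x y} → Ancestor F x y → x ∈ pathToRoot F y
    ∈-pathToRoot⁺ x≼y = ∈-ancestors⁺ (suc _) x≼y ≤-refl

    ∈-pathToRoot-par : ∀ {x y p} → x ∈ pathToRoot F y → par F x ≡ just p → p ∈ pathToRoot F y
    ∈-pathToRoot-par x∈ x→p = ∈-pathToRoot⁺ (ancestor-trans (up x→p here) (∈-pathToRoot⁻ x∈))
    ancestor-present : ∀ {x y} → Ancestor F x y → present F y ≡ true → present F x ≡ true
    ancestor-present here          y-present = y-present
    ancestor-present (up y→p x≼p) _         = ancestor-present x≼p (par-present wf y→p)

    siblings-on-path : ∀ {z u v p} → Ancestor F z v → Ancestor F u v →
                       par F z ≡ just p → par F u ≡ just p → z ≡ u
    siblings-on-path {z} {u} z≼v u≼v z→p u→p with z ≟ u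
    ... | yes z≡u = z≡u
    ... | no z≢u with ancestor-linear z≼v u≼v
    ...   | inj₁ z≼u = ⊥-elim (<⇒≱ (par-< wf z→p) (ancestor-≤ (ancestor-parent z≼u z≢u u→p)))
    ...   | inj₂ u≼z = ⊥-elim (<⇒≱ (par-< wf u→p) (ancestor-≤ (ancestor-parent u≼z (z≢u ∘′ sym) z→p)))

    roots-on-path : ∀ {x x′ y} → Ancestor F x y → par F x ≡ nothing →
                    Ancestor F x′ y → par F x′ ≡ nothing → x ≡ x′
    roots-on-path x≼y x-root x′≼y x′-root with ancestor-linear x≼y x′≼y
    ... | inj₁ x≼x′ = ancestor-of-root x≼x′ x′-root
    ... | inj₂ x′≼x = sym (ancestor-of-root x′≼x x-root)

    rootFuel-irrelevant : ∀ k k′ {x} → x < k → x < k′ → rootFuel F k x ≡ rootFuel F k′ x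
    rootFuel-irrelevant (suc k) (suc k′) {x} x<k x<k′ with par F x in x→
    ... | nothing = refl
    ... | just p  = rootFuel-irrelevant k k′ (<-≤-trans (par-< wf x→) (≤-pred x<k)) (<-≤-trans (par-< wf x→) (≤-pred x<k′))

    root-par : ∀ {x p} → par F x ≡ just p → root F x ≡ root F p
    root-par {x} {p} x→p with par F x | x→p
    ... | just p | refl = rootFuel-irrelevant x (suc p) (par-< wf x→p) ≤-refl

    root-ancestor : ∀ {x y} → Ancestor F x y → root F x ≡ root F y
    root-ancestor here          = refl
    root-ancestor (up y→p x≼p) = trans (root-ancestor x≼p) (sym (root-par y→p))

detach-par : ∀ (f : ℕ → Maybe ℕ) x y → setFun f x nothing y ≡ nothing ⊎ setFun f x nothing y ≡ f y
detach-par f x y with y ≟ x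
... | yes refl = inj₁ (setFun-≡ f x nothing)
... | no y≢x   = inj₂ (setFun-≢ f x nothing y≢x)

detached-par : ∀ (f : ℕ → Maybe ℕ) x {y p} → setFun f x nothing y ≡ just p → f y ≡ just p
detached-par f x {y} y→p with detach-par f x y
... | inj₁ y-root with () ← trans (sym y-root) y→p
... | inj₂ same   = trans (sym same) y→p

detached-root : ∀ (f : ℕ → Maybe ℕ) x {y} → (y ≢ x → f y ≡ nothing) → setFun f x nothing y ≡ nothing
detached-root f x {y} f-root with y ≟ x
... | yes refl = setFun-≡ f x nothing
... | no y≢x   = trans (setFun-≢ f x nothing y≢x) (f-root y≢x)

module _ {F : Forest} (wf : WellFormed F) where

  insert-wf : ∀ x → WellFormed (step F (insert x))
  insert-wf x = record
    { par-<       = λ y→p → par-< wf (detached-par (par F) x y→p)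
    ; par-present = λ y→p → present′ (detached-par (par F) x y→p)
    ; absent-root = λ absent → detached-root (par F) x
                                 (λ y≢x → absent-root wf (trans (sym (setFun-≢ (present F) x true y≢x)) absent))
    }
    where
    present′ : ∀ {y p} → par F y ≡ just p → setFun (present F) x true p ≡ true
    present′ {p = p} y→p with p ≟ x
    ... | yes refl = setFun-≡ (present F) x true
    ... | no p≢x   = trans (setFun-≢ (present F) x true p≢x) (par-present wf y→p)

  cut-wf : ∀ x → WellFormed (step F (cut x))
  cut-wf x = record
    { par-<       = λ y→p → par-< wf (detached-par (par F) x y→p)
    ; par-present = λ y→p → par-present wf (detached-par (par F) x y→p)
    ; absent-root = λ absent → detached-root (par F) x (λ _ → absent-root wf absent)
    }

  delete-wf : ∀ x → (∀ u → present F u ≡ true → par F u ≢ just x) → WellFormed (step F (delete x))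
  delete-wf x childless = record
    { par-<       = λ y→p → par-< wf (detached-par (par F) x y→p)
    ; par-present = λ y→p → present′ (detached-par (par F) x y→p)
    ; absent-root = λ absent → detached-root (par F) x
                                 (λ y≢x → absent-root wf (trans (sym (setFun-≢ (present F) x false y≢x)) absent))
    }
    where
    present′ : ∀ {y p} → par F y ≡ just p → setFun (present F) x false p ≡ true
    present′ {y} {p} y→p with p ≟ x
    ... | yes refl = ⊥-elim (childless y (has-parent⇒present wf y→p) y→p)
    ... | no p≢x   = trans (setFun-≢ (present F) x false p≢x) (par-present wf y→p)

module _ (F : Forest) where

  parentInᵇ : List ℕ → ℕ → Bool
  parentInᵇ M z = maybe′ (λ p → elemᵇ p M) false (par F z)

  rootOnᵇ : List ℕ → ℕ → Bool
  rootOnᵇ L z = elemᵇ z L ∧ is-nothing (par F z)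

  entryᵇ : List ℕ → List ℕ → ℕ → Bool
  entryᵇ L M z = elemᵇ z L ∧ (not (elemᵇ z M) ∧ parentInᵇ M z)

module _ {F : Forest} where

  rootOnᵇ⁺ : ∀ {L z} → z ∈ L → par F z ≡ nothing → T (rootOnᵇ F L z)
  rootOnᵇ⁺ z∈L z-root = from T-∧ (∈⇒elemᵇ z∈L , subst (T ∘′ is-nothing) (sym z-root) _)

  rootOnᵇ⁻ : ∀ {L z} → T (rootOnᵇ F L z) → z ∈ L × par F z ≡ nothing
  rootOnᵇ⁻ {L} {z} t with to T-∧ t
  ... | z∈L , is-root = elemᵇ⇒∈ L z∈L , is-nothing⇒≡ (par F z) is-root
    where
    is-nothing⇒≡ : ∀ (m : Maybe ℕ) → T (is-nothing m) → m ≡ nothing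
    is-nothing⇒≡ nothing _ = refl

  entryᵇ⁺ : ∀ {L M z p} → z ∈ L → z ∉ M → par F z ≡ just p → p ∈ M → T (entryᵇ F L M z)
  entryᵇ⁺ {M = M} z∈L z∉M z→p p∈M =
    from T-∧ (∈⇒elemᵇ z∈L , from T-∧ (T-not⁺ (z∉M ∘′ elemᵇ⇒∈ _) ,
                                      subst (T ∘′ maybe′ (λ p → elemᵇ p M) false) (sym z→p) (∈⇒elemᵇ p∈M)))

  entryᵇ⁻ : ∀ {L M z} → T (entryᵇ F L M z) → z ∈ L × z ∉ M × ∃[ p ] par F z ≡ just p × p ∈ M
  entryᵇ⁻ {L} {M} {z} t with to T-∧ t
  ... | z∈L , t′ with to T-∧ t′
  ...   | z∉M , p∈M = elemᵇ⇒∈ L z∈L , T-not⁻ z∉M ∘′ ∈⇒elemᵇ , parent-in (par F z) p∈M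
    where
    parent-in : ∀ m → T (maybe′ (λ p → elemᵇ p M) false m) → ∃[ p ] m ≡ just p × p ∈ M
    parent-in (just p) p∈M = p , refl , elemᵇ⇒∈ M p∈M

  module _ (wf : WellFormed F) where

    rootOn-unique : ∀ {t z z′} → T (rootOnᵇ F (pathToRoot F t) z) → T (rootOnᵇ F (pathToRoot F t) z′) →
                    z ≡ z′
    rootOn-unique t₁ t₂ with rootOnᵇ⁻ t₁ | rootOnᵇ⁻ t₂
    ... | z∈ , z-root | z′∈ , z′-root = roots-on-path wf (∈-pathToRoot⁻ z∈) z-root (∈-pathToRoot⁻ z′∈) z′-root

    entry-unique : ∀ {t s z z′} → T (entryᵇ F (pathToRoot F t) (pathToRoot F s) z) →
                   T (entryᵇ F (pathToRoot F t) (pathToRoot F s) z′) → z ≡ z′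
    entry-unique {z = z} {z′} t₁ t₂ with entryᵇ⁻ t₁ | entryᵇ⁻ t₂ | z ≟ z′
    ... | _ | _ | yes z≡z′ = z≡z′
    ... | z∈ , z∉ , p , z→p , p∈ | z′∈ , z′∉ , p′ , z′→p′ , p′∈ | no z≢z′
      with ancestor-linear (∈-pathToRoot⁻ z∈) (∈-pathToRoot⁻ z′∈)
    ...   | inj₁ z≼z′ = ⊥-elim (z∉ (∈-pathToRoot⁺ wf (ancestor-trans (ancestor-parent z≼z′ z≢z′ z′→p′)
                                                                  (∈-pathToRoot⁻ p′∈))))
    ...   | inj₂ z′≼z = ⊥-elim (z′∉ (∈-pathToRoot⁺ wf (ancestor-trans (ancestor-parent z′≼z (z≢z′ ∘′ sym) z→p)
                                                                   (∈-pathToRoot⁻ p∈))))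

-- Rank potentials

logGap : (ℕ → ℕ) → ℕ → Maybe ℕ → ℕ
logGap r x (just p) = ⌊log₂ (r x ∸ r p) ⌋
logGap r x nothing  = 0

logGap-≤ : ∀ {r n} → (∀ x → r x ≤ n) → ∀ x q → logGap r x q ≤ ⌊log₂ n ⌋
logGap-≤ {r} r≤n x (just p) = ⌊log₂⌋-mono-≤ (≤-trans (m∸n≤m (r x) (r p)) (r≤n x))
logGap-≤ r≤n x nothing  = z≤n

potential : (ℕ → ℕ) → Forest → ℕ → ℕ
potential r F = sumBelow (λ x → logGap r x (par F x))

potential-detach : ∀ r {F G} → (∀ x → par G x ≡ nothing ⊎ par G x ≡ par F x) →
                   ∀ B → potential r G B ≤ potential r F B
potential-detach r {F} {G} detached = sumBelow-mono-≤ term-≤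
  where
  term-≤ : ∀ x → logGap r x (par G x) ≤ logGap r x (par F x)
  term-≤ x with detached x
  ... | inj₁ x-root = ≤-trans (≤-reflexive (cong (logGap r x) x-root)) z≤n
  ... | inj₂ same   = ≤-reflexive (cong (logGap r x) same)

potential-empty : ∀ r B → potential r emptyForest B ≡ 0
potential-empty r B = sumBelow-zero _ B (λ _ → refl)

-- Merging two root paths

module Merge {F : Forest} (wf : WellFormed F) {v w : ℕ}
             (v-present : present F v ≡ true) (w-present : present F w ≡ true) where

  P Q PQ : List ℕ
  P  = pathToRoot F v
  Q  = pathToRoot F w
  PQ = P ++ Q

  F′ : Forest
  F′ = mergeForest F v w

  ∈PQ⁻ : ∀ {z} → z ∈ PQ → Ancestor F z v ⊎ Ancestor F z w
  ∈PQ⁻ z∈ = Sum.map ∈-pathToRoot⁻ ∈-pathToRoot⁻ (∈-++⁻ P z∈)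

  ∈PQ⇒present : ∀ {z} → z ∈ PQ → present F z ≡ true
  ∈PQ⇒present = [ (λ z≼v → ancestor-present wf z≼v v-present)
                , (λ z≼w → ancestor-present wf z≼w w-present) ]′ ∘′ ∈PQ⁻

  ∈PQ⇒≤ : ∀ {z} → z ∈ PQ → z ≤ v ⊔ w
  ∈PQ⇒≤ = [ (λ z≼v → ≤-trans (ancestor-≤ wf z≼v) (m≤m⊔n v w))
          , (λ z≼w → ≤-trans (ancestor-≤ wf z≼w) (m≤n⊔m v w)) ]′ ∘′ ∈PQ⁻

  ∈PQ-par : ∀ {z p} → z ∈ PQ → par F z ≡ just p → p ∈ PQ
  ∈PQ-par z∈ z→p with ∈-++⁻ P z∈
  ... | inj₁ z∈P = ∈-++⁺ˡ (∈-pathToRoot-par wf z∈P z→p)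
  ... | inj₂ z∈Q = ∈-++⁺ʳ P (∈-pathToRoot-par wf z∈Q z→p)

  par′-∈ : ∀ {z} → z ∈ PQ → par F′ z ≡ largestBelow PQ z
  par′-∈ {z} z∈ with elemᵇ z PQ | ∈⇒elemᵇ z∈
  ... | true | _ = refl

  par′-∉ : ∀ {z} → z ∉ PQ → par F′ z ≡ par F z
  par′-∉ {z} z∉ with elemᵇ z PQ | elemᵇ⇒∈ {z} PQ
  ... | true  | z∈ = ⊥-elim (z∉ (z∈ _))
  ... | false | _  = refl

  merge-wf : WellFormed F′
  merge-wf = record
    { par-<       = λ {x} → new-par-< {x}
    ; par-present = λ {x} → new-par-present {x}
    ; absent-root = λ {x} → new-absent-root {x}
    }
    where
    new-par-< : ∀ {x p} → par F′ x ≡ just p → p < x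
    new-par-< {x} x→p with x ∈? PQ
    ... | yes x∈ with largestBelow PQ x | largestBelow-view PQ x | trans (sym (par′-∈ x∈)) x→p
    ...   | just _ | just _ p<x _ | refl = p<x
    new-par-< {x} x→p | no x∉ = par-< wf (trans (sym (par′-∉ x∉)) x→p)
    new-par-present : ∀ {x p} → par F′ x ≡ just p → present F p ≡ true
    new-par-present {x} x→p with x ∈? PQ
    ... | yes x∈ with largestBelow PQ x | largestBelow-view PQ x | trans (sym (par′-∈ x∈)) x→p
    ...   | just _ | just p∈ _ _ | refl = ∈PQ⇒present p∈
    new-par-present {x} x→p | no x∉ = par-present wf (trans (sym (par′-∉ x∉)) x→p)
    new-absent-root : ∀ {x} → present F x ≡ false → par F′ x ≡ nothing
    new-absent-root {x} absent with x ∈? PQ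
    ... | yes x∈ with () ← trans (sym absent) (∈PQ⇒present x∈)
    ... | no x∉  = trans (par′-∉ x∉) (absent-root wf absent)

  changed : ℕ → Bool
  changed z = not (eqMaybeᵇ (par F′ z) (par F z))

  unchanged : ∀ {z} → ¬ T (changed z) → par F′ z ≡ par F z
  unchanged {z} ¬c with eqMaybeᵇ (par F′ z) (par F z) | eqMaybeᵇ⇒≡ (par F′ z) (par F z)
  ... | true  | eq = eq _
  ... | false | _  = ⊥-elim (¬c _)

  changed-≢ : ∀ {z} → T (changed z) → par F′ z ≢ par F z
  changed-≢ {z} c eq = T-not⁻ c (subst (λ q → T (eqMaybeᵇ q (par F z))) (sym eq) (eqMaybeᵇ-refl (par F z)))

  changed⇒∈PQ : ∀ {z} → T (changed z) → z ∈ PQ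
  changed⇒∈PQ {z} c with z ∈? PQ
  ... | yes z∈ = z∈
  ... | no z∉  = ⊥-elim (changed-≢ c (par′-∉ z∉))

  new-parent : ∀ {z} → T (changed z) → ∃[ y ] par F′ z ≡ just y × LargestBelow PQ z (just y)
  new-parent {z} c = from-view (largestBelow-view PQ z) (par′-∈ (changed⇒∈PQ c))
    where
    from-view : ∀ {l} → LargestBelow PQ z l → par F′ z ≡ l →
                ∃[ y ] par F′ z ≡ just y × LargestBelow PQ z (just y)
    from-view (just y∈ y<z max) z→y = _ , z→y , just y∈ y<z max
    from-view (nothing above)   z→  = ⊥-elim (no-parent (par F z) refl)
      where
      no-parent : ∀ m → par F z ≡ m → ⊥
      no-parent nothing  z→p = changed-≢ c (trans z→ (sym z→p))
      no-parent (just p) z→p = <⇒≱ (par-< wf z→p) (above (∈PQ-par (changed⇒∈PQ c) z→p))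

  new-parent-above : ∀ {z p} → T (changed z) → par F z ≡ just p →
                     ∃[ y ] par F′ z ≡ just y × p < y × LargestBelow PQ z (just y)
  new-parent-above {z} {p} c z→p with new-parent c
  ... | y , z→y , just y∈ y<z max = y , z→y , ≤∧≢⇒< p≤y p≢y , just y∈ y<z max
    where
    p≤y = max (∈PQ-par (changed⇒∈PQ c) z→p) (par-< wf z→p)
    p≢y : p ≢ y
    p≢y refl = changed-≢ c (trans z→y (sym z→p))

  -- Descending from the new parent of z through the unchanged nodes of P ∪ Q above p ends at a
  -- node whose parent is p.
  sibling : ∀ {z p} → T (changed z) → par F z ≡ just p → (∀ {x} → p < x → x < z → ¬ T (changed x)) →
            ∃[ u ] u ∈ PQ × u < z × par F u ≡ just p
  sibling {z} {p} c z→p quiet with new-parent-above c z→p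
  ... | y , _ , p<y , just y∈ y<z _ = descend (<-wellFounded y) y∈ p<y y<z
    where
    p∈ = ∈PQ-par (changed⇒∈PQ c) z→p
    descend : ∀ {y} → Acc _<_ y → y ∈ PQ → p < y → y < z → ∃[ u ] u ∈ PQ × u < z × par F u ≡ just p
    descend {y} (acc smaller) y∈ p<y y<z = from-view (largestBelow-view PQ y) (par′-∈ y∈)
      where
      from-view : ∀ {l} → LargestBelow PQ y l → par F′ y ≡ l → ∃[ u ] u ∈ PQ × u < z × par F u ≡ just p
      from-view (nothing above) _ = ⊥-elim (<⇒≱ p<y (above p∈))
      from-view (just {y′} y′∈ y′<y max) y→y′ with p ≟ y′
      ... | yes refl = y , y∈ , y<z , trans (sym (unchanged (quiet p<y y<z))) y→y′
      ... | no p≢y′  = descend (smaller y′<y) y′∈ (≤∧≢⇒< (max p∈ p<y) p≢y′) (<-trans y′<y y<z)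

  -- Every changed node that its predecessor cannot pay for is of one of these four kinds, and each
  -- kind has at most one member.
  breaks : ℕ → Bool
  breaks z = rootOnᵇ F P z ∨ rootOnᵇ F Q z ∨ entryᵇ F P Q z ∨ entryᵇ F Q P z

  breaks⁺ : ∀ {z} → T (rootOnᵇ F P z) ⊎ T (rootOnᵇ F Q z) ⊎ T (entryᵇ F P Q z) ⊎ T (entryᵇ F Q P z) →
            T (breaks z)
  breaks⁺ {z} = from (T-∨ {rootOnᵇ F P z})
              ∘′ Sum.map₂ (from (T-∨ {rootOnᵇ F Q z}) ∘′ Sum.map₂ (from (T-∨ {entryᵇ F P Q z})))

  root-breaks : ∀ {z} → z ∈ PQ → par F z ≡ nothing → T (breaks z)
  root-breaks {z} z∈ z-root with ∈-++⁻ P z∈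
  ... | inj₁ z∈P = breaks⁺ {z} (inj₁ (rootOnᵇ⁺ {F} z∈P z-root))
  ... | inj₂ z∈Q = breaks⁺ {z} (inj₂ (inj₁ (rootOnᵇ⁺ {F} z∈Q z-root)))

  same-path : ∀ {t u z p} → u ∈ pathToRoot F t → z ∈ pathToRoot F t →
              par F u ≡ just p → par F z ≡ just p → u ≡ z
  same-path u∈ z∈ = siblings-on-path wf (∈-pathToRoot⁻ u∈) (∈-pathToRoot⁻ z∈)

  sibling-breaks : ∀ {z u p} → z ∈ PQ → par F z ≡ just p →
                   u ∈ PQ → u < z → par F u ≡ just p → T (breaks z)
  sibling-breaks {z} z∈ z→p u∈ u<z u→p with ∈-++⁻ P z∈ | ∈-++⁻ P u∈
  ... | inj₁ z∈P | inj₁ u∈P = ⊥-elim (<-irrefl (same-path u∈P z∈P u→p z→p) u<z)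
  ... | inj₂ z∈Q | inj₂ u∈Q = ⊥-elim (<-irrefl (same-path u∈Q z∈Q u→p z→p) u<z)
  ... | inj₁ z∈P | inj₂ u∈Q = breaks⁺ {z} (inj₂ (inj₂ (inj₁
        (entryᵇ⁺ {F} z∈P (λ z∈Q → <-irrefl (same-path u∈Q z∈Q u→p z→p) u<z) z→p (∈-pathToRoot-par wf u∈Q u→p)))))
  ... | inj₂ z∈Q | inj₁ u∈P = breaks⁺ {z} (inj₂ (inj₂ (inj₂
        (entryᵇ⁺ {F} z∈Q (λ z∈P → <-irrefl (same-path u∈P z∈P u→p z→p) u<z) z→p (∈-pathToRoot-par wf u∈P u→p)))))

  parent-breaks : ∀ {z p} → T (changed z) → par F z ≡ just p →
                  (∀ {x} → p < x → x < z → ¬ T (changed x)) → T (breaks z)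
  parent-breaks c z→p quiet with sibling c z→p quiet
  ... | u , u∈ , u<z , u→p = sibling-breaks (changed⇒∈PQ c) z→p u∈ u<z u→p

  #breaks≤4 : ∀ n → sumBelow (λ x → 𝟙 (breaks x)) n ≤ 4
  #breaks≤4 n =
    ≤-trans (sumBelow-𝟙-∨ (rootOnᵇ F P) (λ x → rootOnᵇ F Q x ∨ entryᵇ F P Q x ∨ entryᵇ F Q P x) n) (+-mono-≤ (rootOn≤1 v)
    (≤-trans (sumBelow-𝟙-∨ (rootOnᵇ F Q) (λ x → entryᵇ F P Q x ∨ entryᵇ F Q P x) n) (+-mono-≤ (rootOn≤1 w)
    (≤-trans (sumBelow-𝟙-∨ (entryᵇ F P Q) (entryᵇ F Q P) n) (+-mono-≤ (entry≤1 v w) (entry≤1 w v))))))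
    where
    rootOn≤1 : ∀ t → sumBelow (λ x → 𝟙 (rootOnᵇ F (pathToRoot F t) x)) n ≤ 1
    rootOn≤1 t = sumBelow-𝟙-≤1 _ (rootOn-unique wf) n
    entry≤1 : ∀ t s → sumBelow (λ x → 𝟙 (entryᵇ F (pathToRoot F t) (pathToRoot F s) x)) n ≤ 1
    entry≤1 t s = sumBelow-𝟙-≤1 _ (entry-unique wf) n

  module _ (r : ℕ → ℕ) {n : ℕ} (r≤n : ∀ x → r x ≤ n)
           (r-mono : ∀ {x y} → x ∈ PQ → y ∈ PQ → x < y → r x < r y) where

    private
      a b : ℕ → ℕ
      a x = 2 * logGap r x (par F x)
      b x = logGap r x (par F′ x)

      r-mono-≤ : ∀ {x y} → x ∈ PQ → y ∈ PQ → x ≤ y → r x ≤ r y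
      r-mono-≤ x∈ y∈ x≤y with m≤n⇒m<n∨m≡n x≤y
      ... | inj₁ x<y  = <⇒≤ (r-mono x∈ y∈ x<y)
      ... | inj₂ refl = ≤-refl

    gap-pays : ∀ {c z p} → T (changed c) → T (changed z) → par F z ≡ just p → p < c → c < z → b z + b c < a z
    gap-pays {c} {z} {p} cc cz z→p p<c c<z with new-parent-above cz z→p | new-parent cc
    ... | y , z→y , p<y , just y∈ y<z max | yc , c→yc , just yc∈ yc<c maxc
      = begin-strict
      b z + b c                                 ≡⟨ cong₂ _+_ (cong (logGap r z) z→y) (cong (logGap r c) c→yc) ⟩
      ⌊log₂ (r z ∸ r y) ⌋ + ⌊log₂ (r c ∸ r yc) ⌋ <⟨ ⌊log₂⌋-+-< (m<n⇒0<n∸m (r-mono y∈ z∈ y<z))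
                                                              (m<n⇒0<n∸m (r-mono yc∈ c∈ yc<c)) gaps-fit ⟩
      2 * ⌊log₂ (r z ∸ r p) ⌋                   ≡⟨ cong (λ q → 2 * logGap r z q) (sym z→p) ⟩
      a z                                       ∎
      where
      open ≤-Reasoning
      z∈ = changed⇒∈PQ cz
      c∈ = changed⇒∈PQ cc
      p∈ = ∈PQ-par z∈ z→p
      gaps-fit : (r z ∸ r y) + (r c ∸ r yc) ≤ r z ∸ r p
      gaps-fit = begin
        (r z ∸ r y) + (r c ∸ r yc) ≤⟨ +-monoʳ-≤ (r z ∸ r y) (∸-mono (r-mono-≤ c∈ y∈ (max c∈ c<z))
                                                                   (r-mono-≤ p∈ yc∈ (maxc p∈ p<c))) ⟩
        (r z ∸ r y) + (r y ∸ r p)   ≡⟨ [m∸n]+[n∸o]≡m∸o (r-mono-≤ p∈ y∈ (<⇒≤ p<y))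
                                                      (r-mono-≤ y∈ z∈ (<⇒≤ y<z)) ⟩
        r z ∸ r p                   ∎

    paid-below-parent : ∀ {z p l} → T (changed z) → par F z ≡ just p → LastBelow changed z l →
                        T (breaks z) ⊎ b z + maybe b 0 l < a z
    paid-below-parent cz z→p (none quiet) = inj₁ (parent-breaks cz z→p (λ _ x<z → quiet x<z))
    paid-below-parent {p = p} cz z→p (some {c} c<z cc quiet) with p <? c
    ... | yes p<c = inj₂ (gap-pays cc cz z→p p<c c<z)
    ... | no p≮c  = inj₁ (parent-breaks cz z→p (λ p<x x<z → quiet (≤-<-trans (≮⇒≥ p≮c) p<x) x<z))

    changed-pays : ∀ {z l} → T (changed z) → LastBelow changed z l → T (breaks z) ⊎ b z + maybe b 0 l < a z
    changed-pays {z} {l} cz last = by-parent (par F z) refl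
      where
      by-parent : ∀ m → par F z ≡ m → T (breaks z) ⊎ b z + maybe b 0 l < a z
      by-parent nothing  z-root = inj₁ (root-breaks (changed⇒∈PQ cz) z-root)
      by-parent (just p) z→p    = paid-below-parent cz z→p last

    merge-potential : ∀ {B} → suc (v ⊔ w) ≤ B →
                      parentChanges F v w + 2 * potential r F′ B ≤ 2 * potential r F B + 9 * suc ⌊log₂ n ⌋
    merge-potential {B} v⊔w<B = begin
      parentChanges F v w + 2 * potential r F′ B ≡⟨ cong (_+ 2 * potential r F′ B) parentChanges≡#changed ⟩
      #changed B + 2 * sumBelow b B             ≤⟨ amortized B ⟩
      sumBelow a B + N + K * #breaks B          ≤⟨ +-monoʳ-≤ (sumBelow a B + N) (*-monoʳ-≤ K (#breaks≤4 B)) ⟩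
      sumBelow a B + N + K * 4                  ≡⟨ cong (λ t → t + N + K * 4) (sumBelow-*-distribˡ 2 _ B) ⟩
      2 * potential r F B + N + K * 4           ≤⟨ ≤-reflexive (+-assoc (2 * potential r F B) N (K * 4)) ⟩
      2 * potential r F B + (N + K * 4)         ≤⟨ +-monoʳ-≤ (2 * potential r F B) (constant N) ⟩
      2 * potential r F B + 9 * suc N           ∎
      where
      N = ⌊log₂ n ⌋
      open Amortization changed breaks a b N
             (λ {x} ¬c → cong (λ q → 2 * logGap r x q) (sym (unchanged ¬c)))
             (λ x → logGap-≤ r≤n x (par F′ x)) changed-pays
      open ≤-Reasoning
      parentChanges≡#changed : parentChanges F v w ≡ #changed B
      parentChanges≡#changed =
        trans (countᵇ-upTo changed (suc (v ⊔ w)))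
              (sym (sumBelow-stable _ (suc (v ⊔ w)) (λ v⊔w<x → 𝟙-¬T (λ c → <⇒≱ v⊔w<x (∈PQ⇒≤ (changed⇒∈PQ c))))
                                    v⊔w<B))
      constant : ∀ N → N + (N + N + 1) * 4 ≤ 9 * suc N
      constant N = ≤-trans (m≤m+n _ 5) (≤-reflexive (+5≡ N))
        where
        +5≡ : ∀ N → N + (N + N + 1) * 4 + 5 ≡ 9 * suc N
        +5≡ = solve-∀

step-wf : ∀ {F} o → WellFormed F → Pre F o → WellFormed (step F o)
step-wf (insert x)  wf _                = insert-wf wf x
step-wf (cut x)     wf _                = cut-wf wf x
step-wf (delete x)  wf (_ , childless)  = delete-wf wf x childless
step-wf (merge v w) wf (v-pr , w-pr)    = Merge.merge-wf wf v-pr w-pr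
step-wf (parentQ _) wf _                = wf
step-wf (rootQ _)   wf _                = wf
step-wf (ncaQ _ _)  wf _                = wf

∈-range⁺ : ∀ {a b k} → a ≤ k → k < b → k ∈ range a b
∈-range⁺ {a} {b} a≤k k<b =
  subst (_∈ range a b) (m+[n∸m]≡n a≤k) (∈-map⁺ (a +_) (∈-upTo⁺ (∸-monoˡ-< k<b a≤k)))

∈-range⁻ : ∀ {a b k} → k ∈ range a b → a ≤ k × k < b
∈-range⁻ {a} {b} k∈ with ∈-map⁻ (a +_) k∈
... | i , i∈ , refl = m≤m+n a i , <-≤-trans (+-monoʳ-< a i<b∸a) (≤-reflexive (m+[n∸m]≡n a≤b))
  where
  i<b∸a = ∈-upTo⁻ i∈
  a≤b : a ≤ b
  a≤b = ≮⇒≥ (λ b<a → n≮0 (subst (i <_) (m≤n⇒m∸n≡0 (<⇒≤ b<a)) i<b∸a))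

opAt-take : ∀ (xs : List Op) j {o} → opAt xs j ≡ just o → take (suc j) xs ≡ take j xs ∷ʳ o
opAt-take (x ∷ xs) zero    refl = refl
opAt-take (x ∷ xs) (suc j) e    = cong (x ∷_) (opAt-take xs j e)

opAt-< : ∀ (xs : List Op) j {o} → opAt xs j ≡ just o → j < length xs
opAt-< (x ∷ xs) zero    _ = s≤s z≤n
opAt-< (x ∷ xs) (suc j) e = s≤s (opAt-< xs j e)

drop-∷ : ∀ (xs : List Op) j {o os} → drop j xs ≡ o ∷ os → opAt xs j ≡ just o × drop (suc j) xs ≡ os
drop-∷ (x ∷ xs) zero    refl = refl , refl
drop-∷ (x ∷ xs) (suc j) d    = drop-∷ xs j d

stateBefore-suc : ∀ ops j {o} → opAt ops j ≡ just o → stateBefore ops (suc j) ≡ step (stateBefore ops j) o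
stateBefore-suc ops j {o} e =
  trans (cong (run emptyForest) (opAt-take ops j e)) (foldl-∷ʳ step emptyForest o (take j ops))

insertedLabel : Op → ℕ
insertedLabel (insert x) = x
insertedLabel _          = 0

labelSum : List Op → ℕ
labelSum []       = 0
labelSum (o ∷ os) = insertedLabel o + labelSum os

insert-≤-labelSum : ∀ (xs : List Op) j {x} → opAt xs j ≡ just (insert x) → x ≤ labelSum xs
insert-≤-labelSum (insert y ∷ xs) zero    refl = m≤m+n y (labelSum xs)
insert-≤-labelSum (o ∷ xs)        (suc j) e    = ≤-trans (insert-≤-labelSum xs j e) (m≤n+m _ (insertedLabel o))

InMergedTree : Forest → ℕ → ℕ → ℕ → Set
InMergedTree F z v w = root F z ≡ root F v ⊎ root F z ≡ root F w

module Run (ops : List Op) where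

  Alive : ℕ → ℕ → Set
  Alive j x = ∃[ i ] i < j × opAt ops i ≡ just (insert x) ×
                     (∀ {k} → i < k → k < j → isDeleteOf x (opAt ops k) ≡ false)

  record Good (j : ℕ) (F : Forest) : Set where
    field
      wf    : WellFormed F
      alive : ∀ {x} → present F x ≡ true → Alive j x
  open Good

  alive-extend : ∀ {j x o} → opAt ops j ≡ just o → isDeleteOf x (just o) ≡ false → Alive j x → Alive (suc j) x
  alive-extend {j} {x} e kept (i , i<j , ins , undeleted) = i , m<n⇒m<1+n i<j , ins , undeleted′
    where
    undeleted′ : ∀ {k} → i < k → k < suc j → isDeleteOf x (opAt ops k) ≡ false
    undeleted′ {k} i<k k<1+j with m≤n⇒m<n∨m≡n (≤-pred k<1+j)
    ... | inj₁ k<j  = undeleted i<k k<j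
    ... | inj₂ refl = trans (cong (isDeleteOf x) e) kept

  alive-inserted : ∀ {j x} → opAt ops j ≡ just (insert x) → Alive (suc j) x
  alive-inserted e = _ , ≤-refl , e , λ j<k k<1+j → ⊥-elim (<-irrefl refl (<-≤-trans j<k (≤-pred k<1+j)))

  alive-step : ∀ {j F x} o → opAt ops j ≡ just o → Good j F → present (step F o) x ≡ true → Alive (suc j) x
  alive-step {F = F} {x} (insert y) e good x-present with x ≟ y
  ... | yes refl = alive-inserted e
  ... | no x≢y   = alive-extend e refl (alive good (trans (sym (setFun-≢ (present F) y true x≢y)) x-present))
  alive-step {F = F} {x} (delete y) e good x-present with x ≟ y
  ... | yes refl with () ← trans (sym (setFun-≡ (present F) y false)) x-present
  ... | no x≢y   =
    alive-extend e (≢⇒≡ᵇ≡false x≢y) (alive good (trans (sym (setFun-≢ (present F) y false x≢y)) x-present))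
  alive-step (cut _)     e good x-present = alive-extend e refl (alive good x-present)
  alive-step (merge _ _) e good x-present = alive-extend e refl (alive good x-present)
  alive-step (parentQ _) e good x-present = alive-extend e refl (alive good x-present)
  alive-step (rootQ _)   e good x-present = alive-extend e refl (alive good x-present)
  alive-step (ncaQ _ _)  e good x-present = alive-extend e refl (alive good x-present)

  good-step : ∀ {j F o} → opAt ops j ≡ just o → Pre F o → Good j F → Good (suc j) (step F o)
  good-step {o = o} e pre good = record { wf = step-wf o (wf good) pre ; alive = alive-step o e good }

  good-empty : Good 0 emptyForest
  good-empty = record
    { wf    = record { par-< = λ () ; par-present = λ () ; absent-root = λ _ → refl }
    ; alive = λ ()
    }

  -- Every inserted label is below B, so potentials need only be summed over x < B.
  B : ℕ
  B = suc (labelSum ops)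

  alive⇒<B : ∀ {j x} → Alive j x → x < B
  alive⇒<B (i , _ , ins , _) = s≤s (insert-≤-labelSum ops i ins)

  insertsBelow : ℕ → ℕ → Bool
  insertsBelow x e with opAt ops e
  ... | just (insert y) = y <ᵇ x
  ... | _               = false

  insertsBelow-mono : ∀ {x y} → y < x → ∀ {e} → T (insertsBelow y e) → T (insertsBelow x e)
  insertsBelow-mono {x} {y} y<x {e} t with opAt ops e
  ... | just (insert u) = <⇒<ᵇ (<-trans (<ᵇ⇒< u y t) y<x)

  -- Ranks do not depend on time, are at most n, and increase strictly along the labels of the
  -- nodes touched by a merge, because the insertions of those nodes participate.
  rank : ℕ → ℕ
  rank x = countᵇ (λ e → insertParticipates ops e ∧ insertsBelow x e) (upTo (length ops))

  rank≤ : ∀ x → rank x ≤ numParticipating ops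
  rank≤ x = countᵇ-mono (λ {e} t → proj₁ (to (T-∧ {insertParticipates ops e}) t)) (upTo (length ops))

  merge-touches : ∀ {j z v w} → opAt ops j ≡ just (merge v w) → InMergedTree (stateBefore ops j) z v w →
                  T (mergeTouches ops z j)
  merge-touches {j} mrg same-tree rewrite mrg = from T-∨ (Sum.map (≡⇒≡ᵇ _ _) (≡⇒≡ᵇ _ _) same-tree)

  insertion-participates : ∀ {i j z v w} → opAt ops i ≡ just (insert z) → opAt ops j ≡ just (merge v w) → i < j →
                           (∀ {k} → i < k → k < j → isDeleteOf z (opAt ops k) ≡ false) →
                           InMergedTree (stateBefore ops j) z v w → T (insertParticipates ops i)
  insertion-participates {i} {j} {z} ins mrg i<j undeleted same-tree rewrite ins =
    any⁺ _ (lose (∈-range⁺ i<j (opAt-< ops j mrg))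
                 (from T-∧ (merge-touches mrg same-tree , all⁻ _ (All.tabulate kept))))
    where
    kept : ∀ {k} → k ∈ range (suc i) j → T (not (isDeleteOf z (opAt ops k)))
    kept k∈ with ∈-range⁻ k∈
    ... | i<k , k<j = subst (T ∘′ not) (sym (undeleted i<k k<j)) _

  insertsBelow-at : ∀ {e u} x → opAt ops e ≡ just (insert u) → insertsBelow x e ≡ (u <ᵇ x)
  insertsBelow-at x ins rewrite ins = refl

  module AtMerge {j F v w} (mrg : opAt ops j ≡ just (merge v w)) (state≡ : stateBefore ops j ≡ F)
                 (good : Good j F) (v-present : present F v ≡ true) (w-present : present F w ≡ true) where
    open Merge (wf good) v-present w-present

    rank-mono : ∀ {x y} → x ∈ PQ → y ∈ PQ → x < y → rank x < rank y
    rank-mono {x} {y} x∈ y∈ x<y with alive good (∈PQ⇒present x∈)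
    ... | i , i<j , ins , undeleted =
      countᵇ-mono-< (from T-∧ ∘′ Product.map₂ (insertsBelow-mono x<y) ∘′ to T-∧)
                    (∈-upTo⁺ (<-trans i<j (opAt-< ops j mrg))) not-below-x below-y
      where
      same-tree : InMergedTree (stateBefore ops j) x v w
      same-tree = subst (λ G → InMergedTree G x v w) (sym state≡)
                        (Sum.map (root-ancestor (wf good)) (root-ancestor (wf good)) (∈PQ⁻ x∈))
      not-below-x : ¬ T (insertParticipates ops i ∧ insertsBelow x i)
      not-below-x t = <-irrefl refl (<ᵇ⇒< x x (subst T (insertsBelow-at x ins)
                                                     (proj₂ (to (T-∧ {insertParticipates ops i}) t))))
      below-y : T (insertParticipates ops i ∧ insertsBelow y i)
      below-y = from T-∧ (insertion-participates ins mrg i<j undeleted same-tree ,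
                          subst T (sym (insertsBelow-at y ins)) (<⇒<ᵇ x<y))

    potential-merge : parentChanges F v w + 2 * potential rank (mergeForest F v w) B ≤
                      2 * potential rank F B + 9 * suc ⌊log₂ numParticipating ops ⌋
    potential-merge =
      merge-potential rank rank≤ rank-mono (⊔-lub (alive⇒<B (alive good v-present)) (alive⇒<B (alive good w-present)))

  C : ℕ
  C = 9 * suc ⌊log₂ numParticipating ops ⌋

  Φ : Forest → ℕ
  Φ F = potential rank F B

  bound-detach : ∀ F o m {t} → (∀ x → par (step F o) x ≡ nothing ⊎ par (step F o) x ≡ par F x) →
                 t ≤ 2 * Φ (step F o) + C * m → t ≤ 2 * Φ F + C * m
  bound-detach F o m detached t≤ =
    ≤-trans t≤ (+-monoˡ-≤ (C * m) (*-monoʳ-≤ 2 (potential-detach rank {F} {step F o} detached B)))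

  bound-merge : ∀ pc ΦF ΦG m {t} → pc + 2 * ΦG ≤ 2 * ΦF + C → t ≤ 2 * ΦG + C * m → pc + t ≤ 2 * ΦF + C * suc m
  bound-merge pc ΦF ΦG m {t} step t≤ = begin
    pc + t                    ≤⟨ +-monoʳ-≤ pc t≤ ⟩
    pc + (2 * ΦG + C * m)     ≡⟨ sym (+-assoc pc (2 * ΦG) (C * m)) ⟩
    pc + 2 * ΦG + C * m       ≤⟨ +-monoˡ-≤ (C * m) step ⟩
    2 * ΦF + C + C * m        ≡⟨ trans (+-assoc (2 * ΦF) C (C * m)) (cong (2 * ΦF +_) (sym (*-suc C m))) ⟩
    2 * ΦF + C * suc m        ∎
    where open ≤-Reasoning

  telescope : ∀ {j F os} → drop j ops ≡ os → stateBefore ops j ≡ F → Valid F os → Good j F →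
              totalChanges F os ≤ 2 * Φ F + C * numMerges os
  telescope-next : ∀ {j F o os} → drop j ops ≡ o ∷ os → stateBefore ops j ≡ F → Pre F o → Valid (step F o) os →
                   Good j F → totalChanges (step F o) os ≤ 2 * Φ (step F o) + C * numMerges os

  telescope {os = []} _ _ _ _ = z≤n
  telescope {j} {F} {merge v w ∷ os} d s (pre@(v-pr , w-pr) , valid) good =
    bound-merge (parentChanges F v w) (Φ F) (Φ (mergeForest F v w)) (numMerges os)
                (AtMerge.potential-merge (proj₁ (drop-∷ ops j d)) s good v-pr w-pr) (telescope-next d s pre valid good)
  telescope {F = F} {insert x ∷ os} d s (pre , valid) good =
    bound-detach F (insert x) (numMerges os) (detach-par (par F) x) (telescope-next d s pre valid good)
  telescope {F = F} {cut x ∷ os} d s (pre , valid) good =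
    bound-detach F (cut x) (numMerges os) (detach-par (par F) x) (telescope-next d s pre valid good)
  telescope {F = F} {delete x ∷ os} d s (pre , valid) good =
    bound-detach F (delete x) (numMerges os) (detach-par (par F) x) (telescope-next d s pre valid good)
  telescope {os = parentQ _ ∷ os} d s (pre , valid) good = telescope-next d s pre valid good
  telescope {os = rootQ _ ∷ os}   d s (pre , valid) good = telescope-next d s pre valid good
  telescope {os = ncaQ _ _ ∷ os}  d s (pre , valid) good = telescope-next d s pre valid good

  telescope-next {j} {F} {o} d s pre valid good =
    telescope (proj₂ (drop-∷ ops j d)) (trans (stateBefore-suc ops j e) (cong (λ G → step G o) s)) valid (good-step e pre good)
    where e = proj₁ (drop-∷ ops j d)

  totalChanges-≤ : Valid emptyForest ops → totalChanges emptyForest ops ≤ C * numMerges ops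
  totalChanges-≤ valid = subst (λ t → totalChanges emptyForest ops ≤ 2 * t + C * numMerges ops) (potential-empty rank B)
                               (telescope refl refl valid good-empty)

lemma1 : ∃[ c ] ((ops : List Op) → Valid emptyForest ops →
           totalChanges emptyForest ops ≤ c * numMerges ops * suc ⌊log₂ numParticipating ops ⌋)
lemma1 = 9 , λ ops valid → ≤-trans (Run.totalChanges-≤ ops valid) (≤-reflexive (xy∙z≈xz∙y 9 _ (numMerges ops)))
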